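{- Let $E_1,E_2\subseteq\mathbb{Z}_N$ be nonempty and let $A\subseteq E_1\times E_2$ with $|A|=\delta|E_1||E_2|$. Let $\alpha>0$ and suppose $A$ is not $\alpha$-uniform with respect to the basis $(\vec e_1,\vec e_2)$. Then there exist $G_1\subseteq E_1$, $G_2\subseteq E_2$ such that $|A\cap(G_1\times G_2)|>(\delta+2^{ -500}\alpha^{70})|G_1||G_2|$ and $|G_1|,|G_2|>2^{ -500}\alpha^{70}\min\{|E_1|,|E_2|\}$.
   Context: For $y\in\mathbb{Z}_N$ let $\delta_y=\frac{1}{|E_1|}|\{x\in E_1:(x,y)\in A\}|$ and $f(x,y)=(\chi_A(x,y)-\delta_y)\chi_{E_1\times E_2}(x,y)$. $A$ is $\alpha$-uniform with respect to the basis $(\vec e_1,\vec e_2)$ if $\sum_{y,y'\in\mathbb{Z}_N}\big|\sum_{x\in\mathbb{Z}_N}f(x,y)\overline{f(x,y')}\big|^2\le\alpha|E_1|^2|E_2|^2$.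
   Formalization: The parameter α ranges over the positive rationals instead of the positive reals. -}

module Defs where

open import Data.Nat using (ℕ; zero; suc)
open import Data.Bool using (Bool; true; false; _∧_)
open import Data.Fin using (Fin)
open import Data.Fin.Subset using (Subset; ∣_∣)
open import Data.Vec using (lookup)
open import Data.Integer using (+_)
open import Data.Rational using (ℚ; 0ℚ; 1ℚ; _+_; _-_; _*_; _/_; _≤_)

∑ : (n : ℕ) → (Fin n → ℚ) → ℚ
∑ zero    f = 0ℚ
∑ (suc n) f = f Fin.zero + ∑ n (λ i → f (Fin.suc i))

ℕ→ℚ : ℕ → ℚ
ℕ→ℚ n = (+ n) / 1

χ : Bool → ℚ
χ true  = 1ℚ
χ false = 0ℚ

_^ℚ_ : ℚ → ℕ → ℚ
q ^ℚ zero  = 1ℚ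
q ^ℚ suc n = q * (q ^ℚ n)

-- q / n for a natural n (only used with n ≠ 0; returns 0 when n = 0).
_/ℕ_ : ℚ → ℕ → ℚ
q /ℕ zero  = 0ℚ
q /ℕ suc k = q * ((+ 1) / suc k)

Rel : ℕ → Set
Rel N = Fin N → Fin N → Bool

card : {N : ℕ} → Rel N → ℚ
card {N} A = ∑ N (λ x → ∑ N (λ y → χ (A x y)))

cardIn : {N : ℕ} → Rel N → Subset N → Subset N → ℚ
cardIn {N} A G₁ G₂ =
  ∑ N (λ x → ∑ N (λ y → χ (A x y ∧ (lookup G₁ x ∧ lookup G₂ y))))

δ[_] : {N : ℕ} → Subset N → Rel N → Fin N → ℚ
δ[_] {N} E₁ A y = ∑ N (λ x → χ (lookup E₁ x ∧ A x y)) /ℕ ∣ E₁ ∣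

-- f(x,y) = (χ_A(x,y) − δ_y) χ_{E₁×E₂}(x,y)   (real-valued, so conj f = f)
balanced : {N : ℕ} → Subset N → Subset N → Rel N → Fin N → Fin N → ℚ
balanced E₁ E₂ A x y =
  (χ (A x y) - δ[ E₁ ] A y) * χ (lookup E₁ x ∧ lookup E₂ y)

Uniform : {N : ℕ} → ℚ → Subset N → Subset N → Rel N → Set
Uniform {N} α E₁ E₂ A =
  ∑ N (λ y → ∑ N (λ y' →
      (∑ N (λ x → f x y * f x y')) ^ℚ 2))
    ≤ α * ((ℕ→ℚ ∣ E₁ ∣ ^ℚ 2) * (ℕ→ℚ ∣ E₂ ∣ ^ℚ 2))
  where f = balanced E₁ E₂ A

{-# OPTIONS --safe #-}
-- Write f for the balanced function and g(y, y′) = Σₓ f(x, y) f(x, y′) for its Gram matrix, so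
-- that non-uniformity reads Σ g² > α |E₁|² |E₂|². As |f| ≤ 1 on E₁ × E₂ and f vanishes elsewhere,
-- |g| ≤ |E₁|, so Σ |g| > α |E₁| |E₂|² (which also forces α < 1) and some row y₀ ∈ E₂ has
-- Σ_{y′} |g(y₀, y′)| > α |E₁| |E₂|. Splitting y′ by the sign of g(y₀, y′) gives T ⊆ E₂ with
-- Σₓ |Σ_{y∈T} f(x, y)| > α |E₁| |E₂| / 2; as the columns of f sum to 0, the set S ⊆ E₁ where
-- Σ_{y∈T} f(x, y) > 0 carries half of this mass, so Σ_{S×T} f > α |E₁| |E₂| / 4.
-- Now Σ_{S×T} f = |A ∩ (S × T)| − |S| Σ_{y∈T} δ_y, so with η = α/8 either S × T or, when
-- Σ_{y∈T} δ_y < δ |T| − η |E₂|, the rectangle E₁ × (E₂ ∖ T) satisfies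
-- |A ∩ (G₁ × G₂)| > δ |G₁| |G₂| + η |E₁| |E₂|. Such a gain forces |Gᵢ| > η |Eᵢ|, and 2⁻⁵⁰⁰ α⁷⁰ ≤ α/8.
module Submission where

open import Defs
open import Data.Nat using (ℕ; _^_)
open import Relation.Binary.PropositionalEquality using (_≡_)
open import Data.Nat.Base using (_⊓_)
open import Data.Bool using (T)
open import Data.Product using (Σ; _×_; ∃₂)
open import Data.Fin.Subset using (Subset; _∈_; _⊆_; ∣_∣; Nonempty)
open import Data.Integer using (+_)
open import Data.Rational using (ℚ; 0ℚ; _+_; _*_; _/_; _<_)
open import Relation.Nullary using (¬_)

open import Algebra.Bundles using (CommutativeMonoid; CommutativeRing)
import Algebra.Properties.CommutativeSemigroup as CommutativeSemigroupProperties
import Algebra.Properties.Ring as RingProperties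
import Algebra.Properties.Semiring.Sum as SemiringSum
open import Data.Bool using (true; false; _∧_; not)
open import Data.Bool.Properties using (∧-identityʳ)
open import Data.Fin using (Fin; zero; suc)
open import Data.Fin.Subset using (_∉_; _∩_; ∁; ⁅_⁆)
open import Data.Fin.Subset.Properties
  using (_∈?_; ⊆-refl; p∩q⊆p; p⊆q⇒∣p∣≤∣q∣; ∣⁅x⁆∣≡1; x∈⁅y⁆⇒x≡y)
import Data.Integer as ℤ
import Data.Integer.Properties as ℤ
open import Data.List using ([]; _∷_)
import Data.Nat as ℕ
open import Data.Nat.Coprimality using (1-coprimeTo) renaming (sym to coprime-sym)
import Data.Nat.Properties as ℕ
open import Data.Product using (_,_; ∃)
open import Data.Rational
  using (1ℚ; _-_; -_; 1/_; _≤_; ½; mkℚ; nonNegative; positive; toℚᵘ; *≤*)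
  renaming (∣_∣ to abs)
open import Data.Rational.Properties
import Data.Rational.Unnormalised as ℚᵘ
import Data.Rational.Unnormalised.Properties as ℚᵘ
open import Data.Sum using (_⊎_; inj₁; inj₂)
open import Data.Vec using (lookup; tabulate)
import Data.Vec as Vec
open import Data.Vec.Properties
  using (lookup∘tabulate; lookup-map; lookup-zipWith; []=⇒lookup; lookup⇒[]=)
open import Level using (0ℓ)
open import Relation.Binary.PropositionalEquality
  using (refl; sym; trans; cong; cong₂; subst; subst₂; module ≡-Reasoning)
open import Relation.Nullary using (Dec; yes; no; does; contradiction)
open import Relation.Nullary.Decidable using (dec⇒maybe; toWitness)
open import Tactic.RingSolver using (solve; solve-∀)
open import Tactic.RingSolver.Core.AlmostCommutativeRing
  using (AlmostCommutativeRing; fromCommutativeRing)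

ℚ-ring : AlmostCommutativeRing 0ℓ 0ℓ
ℚ-ring = fromCommutativeRing +-*-commutativeRing (λ q → dec⇒maybe (0ℚ ≟ q))

open CommutativeSemigroupProperties (CommutativeMonoid.commutativeSemigroup *-1-commutativeMonoid)
  using (x∙yz≈y∙xz)
open RingProperties +-*-ring using (x[y-z]≈xy-xz; [y-z]x≈yx-zx)

*-monoˡ-≤-0≤ : ∀ {p q r} → 0ℚ ≤ r → p ≤ q → r * p ≤ r * q
*-monoˡ-≤-0≤ {r = r} 0≤r = *-monoˡ-≤-nonNeg r ⦃ nonNegative 0≤r ⦄

*-monoʳ-≤-0≤ : ∀ {p q r} → 0ℚ ≤ r → p ≤ q → p * r ≤ q * r
*-monoʳ-≤-0≤ {r = r} 0≤r = *-monoʳ-≤-nonNeg r ⦃ nonNegative 0≤r ⦄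

*-mono-≤-0≤ : ∀ {p q r s} → 0ℚ ≤ p → 0ℚ ≤ r → p ≤ q → r ≤ s → p * r ≤ q * s
*-mono-≤-0≤ 0≤p 0≤r p≤q r≤s =
  ≤-trans (*-monoʳ-≤-0≤ 0≤r p≤q) (*-monoˡ-≤-0≤ (≤-trans 0≤p p≤q) r≤s)

*-monoʳ-<-0< : ∀ {p q r} → 0ℚ < r → p < q → r * p < r * q
*-monoʳ-<-0< {r = r} 0<r = *-monoʳ-<-pos r ⦃ positive 0<r ⦄

*-cancelˡ-<-0≤ : ∀ {p q r} → 0ℚ ≤ r → r * p < r * q → p < q
*-cancelˡ-<-0≤ {r = r} 0≤r = *-cancelˡ-<-nonNeg r ⦃ nonNegative 0≤r ⦄

*-cancelʳ-<-0≤ : ∀ {p q r} → 0ℚ ≤ r → p * r < q * r → p < q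
*-cancelʳ-<-0≤ {r = r} 0≤r = *-cancelʳ-<-nonNeg r ⦃ nonNegative 0≤r ⦄

*-preserves-0≤ : ∀ {p q} → 0ℚ ≤ p → 0ℚ ≤ q → 0ℚ ≤ p * q
*-preserves-0≤ {p} {q} 0≤p 0≤q =
  nonNegative⁻¹ (p * q) ⦃ nonNeg*nonNeg⇒nonNeg p ⦃ nonNegative 0≤p ⦄ q ⦃ nonNegative 0≤q ⦄ ⦄

*-preserves-0< : ∀ {p q} → 0ℚ < p → 0ℚ < q → 0ℚ < p * q
*-preserves-0< {p} {q} 0<p 0<q =
  positive⁻¹ (p * q) ⦃ pos*pos⇒pos p ⦃ positive 0<p ⦄ q ⦃ positive 0<q ⦄ ⦄

0≤1 : 0ℚ ≤ 1ℚ
0≤1 = *≤* (ℤ.+≤+ ℕ.z≤n)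

*-<-*⇒< : ∀ {p q r s} → 0ℚ ≤ p → 0ℚ ≤ q → q ≤ s → r * s < p * q → r < p
*-<-*⇒< 0≤p 0≤q q≤s rs<pq = ≰⇒> λ p≤r → <-irrefl refl (<-≤-trans rs<pq (*-mono-≤-0≤ 0≤p 0≤q p≤r q≤s))

∣p-q∣≤1 : ∀ {p q} → 0ℚ ≤ p → p ≤ 1ℚ → 0ℚ ≤ q → q ≤ 1ℚ → abs (p - q) ≤ 1ℚ
∣p-q∣≤1 {p} {q} 0≤p p≤1 0≤q q≤1 with ∣p∣≡p∨∣p∣≡-p (p - q)
... | inj₁ ∣p-q∣≡p-q = begin
  abs (p - q) ≡⟨ ∣p-q∣≡p-q ⟩
  p - q       ≤⟨ +-mono-≤ p≤1 (neg-antimono-≤ 0≤q) ⟩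
  1ℚ - 0ℚ     ≡⟨⟩
  1ℚ          ∎
  where open ≤-Reasoning
... | inj₂ ∣p-q∣≡q-p = begin
  abs (p - q) ≡⟨ ∣p-q∣≡q-p ⟩
  - (p - q)   ≡⟨ solve (p ∷ q ∷ []) ℚ-ring ⟩
  q - p       ≤⟨ +-mono-≤ q≤1 (neg-antimono-≤ 0≤p) ⟩
  1ℚ - 0ℚ     ≡⟨⟩
  1ℚ          ∎
  where open ≤-Reasoning

0≤½ : 0ℚ ≤ ½
0≤½ = *≤* (ℤ.+≤+ ℕ.z≤n)

p≤∣p∣ : ∀ p → p ≤ abs p
p≤∣p∣ p with ≤-total 0ℚ p
... | inj₁ 0≤p = ≤-reflexive (sym (0≤p⇒∣p∣≡p 0≤p))
... | inj₂ p≤0 = ≤-trans p≤0 (0≤∣p∣ p)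

∣p∣≤1⇒p*q≤∣q∣ : ∀ {p} q → abs p ≤ 1ℚ → p * q ≤ abs q
∣p∣≤1⇒p*q≤∣q∣ {p} q ∣p∣≤1 = begin
  p * q             ≤⟨ p≤∣p∣ (p * q) ⟩
  abs (p * q)       ≡⟨ ∣p*q∣≡∣p∣*∣q∣ p q ⟩
  abs p * abs q     ≤⟨ *-monoʳ-≤-0≤ (0≤∣p∣ q) ∣p∣≤1 ⟩
  1ℚ * abs q        ≡⟨ *-identityˡ (abs q) ⟩
  abs q             ∎
  where open ≤-Reasoning

p²≡∣p∣*∣p∣ : ∀ p → p ^ℚ 2 ≡ abs p * abs p
p²≡∣p∣*∣p∣ p with ∣p∣≡p∨∣p∣≡-p p
... | inj₁ ∣p∣≡p  rewrite ∣p∣≡p  = cong (p *_) (*-identityʳ p)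
... | inj₂ ∣p∣≡-p rewrite ∣p∣≡-p = p*[p*1]≡-p*-p p
  where
  p*[p*1]≡-p*-p : ∀ p → p * (p * 1ℚ) ≡ - p * - p
  p*[p*1]≡-p*-p = solve-∀ ℚ-ring

0≤p² : ∀ p → 0ℚ ≤ p ^ℚ 2
0≤p² p = subst (0ℚ ≤_) (sym (p²≡∣p∣*∣p∣ p)) (*-preserves-0≤ (0≤∣p∣ p) (0≤∣p∣ p))

∣p∣≤q⇒p²≤q*∣p∣ : ∀ {p q} → abs p ≤ q → p ^ℚ 2 ≤ q * abs p
∣p∣≤q⇒p²≤q*∣p∣ {p} {q} ∣p∣≤q = subst (_≤ q * abs p) (sym (p²≡∣p∣*∣p∣ p)) (*-monoʳ-≤-0≤ (0≤∣p∣ p) ∣p∣≤q)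

∣p∣≤0⇒p≡0 : ∀ {p} → abs p ≤ 0ℚ → p ≡ 0ℚ
∣p∣≤0⇒p≡0 {p} ∣p∣≤0 = ∣p∣≡0⇒p≡0 p (≤-antisym ∣p∣≤0 (0≤∣p∣ p))

[p+p]*½≡p : ∀ p → (p + p) * ½ ≡ p
[p+p]*½≡p = solve-∀ ℚ-ring

[p+q]*½≤p : ∀ {p q} → q ≤ p → (p + q) * ½ ≤ p
[p+q]*½≤p {p} {q} q≤p = begin
  (p + q) * ½   ≤⟨ *-monoʳ-≤-0≤ 0≤½ (+-monoʳ-≤ p q≤p) ⟩
  (p + p) * ½   ≡⟨ [p+p]*½≡p p ⟩
  p             ∎
  where open ≤-Reasoning

0≤pᵏ : ∀ {p} → 0ℚ ≤ p → ∀ k → 0ℚ ≤ p ^ℚ k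
0≤pᵏ 0≤p ℕ.zero    = 0≤1
0≤pᵏ 0≤p (ℕ.suc k) = *-preserves-0≤ 0≤p (0≤pᵏ 0≤p k)

pᵏ≤1 : ∀ {p} → 0ℚ ≤ p → p ≤ 1ℚ → ∀ k → p ^ℚ k ≤ 1ℚ
pᵏ≤1 0≤p p≤1 ℕ.zero    = ≤-refl
pᵏ≤1 0≤p p≤1 (ℕ.suc k) = *-mono-≤-0≤ 0≤p (0≤pᵏ 0≤p k) p≤1 (pᵏ≤1 0≤p p≤1 k)

p¹⁺ᵏ≤p : ∀ {p} → 0ℚ ≤ p → p ≤ 1ℚ → ∀ k → p ^ℚ ℕ.suc k ≤ p
p¹⁺ᵏ≤p {p} 0≤p p≤1 k = subst (p ^ℚ ℕ.suc k ≤_) (*-identityʳ p) (*-monoˡ-≤-0≤ 0≤p (pᵏ≤1 0≤p p≤1 k))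

_⁺ : ℚ → ℚ
p ⁺ = χ (does (0ℚ <? p)) * p

0≤p⇒p⁺≡p : ∀ {p} → 0ℚ ≤ p → p ⁺ ≡ p
0≤p⇒p⁺≡p {p} 0≤p = by-sign (0ℚ <? p)
  where
  by-sign : (0<p? : Dec (0ℚ < p)) → χ (does 0<p?) * p ≡ p
  by-sign (yes _)   = *-identityˡ p
  by-sign (no  0≮p) = trans (*-zeroˡ p) (≤-antisym 0≤p (≮⇒≥ 0≮p))

p≤0⇒p⁺≡0 : ∀ {p} → p ≤ 0ℚ → p ⁺ ≡ 0ℚ
p≤0⇒p⁺≡0 {p} p≤0 = by-sign (0ℚ <? p)
  where
  by-sign : (0<p? : Dec (0ℚ < p)) → χ (does 0<p?) * p ≡ 0ℚ
  by-sign (yes 0<p) = contradiction (<-≤-trans 0<p p≤0) (<-irrefl refl)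
  by-sign (no  _)   = *-zeroˡ p

∣p∣≡p⁺+[-p]⁺ : ∀ p → abs p ≡ p ⁺ + (- p) ⁺
∣p∣≡p⁺+[-p]⁺ p with ≤-total 0ℚ p
... | inj₁ 0≤p = begin
  abs p              ≡⟨ 0≤p⇒∣p∣≡p 0≤p ⟩
  p                  ≡⟨ sym (+-identityʳ p) ⟩
  p + 0ℚ             ≡⟨ sym (cong₂ _+_ (0≤p⇒p⁺≡p 0≤p) (p≤0⇒p⁺≡0 (neg-antimono-≤ 0≤p))) ⟩
  p ⁺ + (- p) ⁺      ∎
  where open ≡-Reasoning
... | inj₂ p≤0 = begin
  abs p              ≡⟨ sym (∣-p∣≡∣p∣ p) ⟩
  abs (- p)          ≡⟨ 0≤p⇒∣p∣≡p 0≤-p ⟩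
  - p                ≡⟨ sym (+-identityˡ (- p)) ⟩
  0ℚ + - p           ≡⟨ sym (cong₂ _+_ (p≤0⇒p⁺≡0 p≤0) (0≤p⇒p⁺≡p 0≤-p)) ⟩
  p ⁺ + (- p) ⁺      ∎
  where
  open ≡-Reasoning
  0≤-p : 0ℚ ≤ - p
  0≤-p = neg-antimono-≤ p≤0

∣p∣+p≡p⁺+p⁺ : ∀ p → abs p + p ≡ p ⁺ + p ⁺
∣p∣+p≡p⁺+p⁺ p with ≤-total 0ℚ p
... | inj₁ 0≤p = trans (cong (_+ p) (0≤p⇒∣p∣≡p 0≤p)) (sym (cong₂ _+_ (0≤p⇒p⁺≡p 0≤p) (0≤p⇒p⁺≡p 0≤p)))
... | inj₂ p≤0 = begin
  abs p + p          ≡⟨ cong (_+ p) (trans (sym (∣-p∣≡∣p∣ p)) (0≤p⇒∣p∣≡p (neg-antimono-≤ p≤0))) ⟩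
  - p + p            ≡⟨ +-inverseˡ p ⟩
  0ℚ                 ≡⟨ sym (cong₂ _+_ (p≤0⇒p⁺≡0 p≤0) (p≤0⇒p⁺≡0 p≤0)) ⟩
  p ⁺ + p ⁺          ∎
  where open ≡-Reasoning

ℕ→ℚ≡mkℚ : ∀ n → ℕ→ℚ n ≡ mkℚ (+ n) 0 (coprime-sym (1-coprimeTo n))
ℕ→ℚ≡mkℚ n = normalize-coprime {n} {0} (coprime-sym (1-coprimeTo n))

ℕ→ℚ-suc : ∀ n → ℕ→ℚ (ℕ.suc n) ≡ 1ℚ + ℕ→ℚ n
ℕ→ℚ-suc n = toℚᵘ-injective (ℚᵘ.≃-trans suc≃1+ (ℚᵘ.≃-sym (toℚᵘ-homo-+ 1ℚ (ℕ→ℚ n))))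
  where
  suc≃1+ : toℚᵘ (ℕ→ℚ (ℕ.suc n)) ℚᵘ.≃ toℚᵘ 1ℚ ℚᵘ.+ toℚᵘ (ℕ→ℚ n)
  suc≃1+ rewrite ℕ→ℚ≡mkℚ n | ℕ→ℚ≡mkℚ (ℕ.suc n) =
    ℚᵘ.*≡* (cong (λ k → (+ 1 ℤ.+ k) ℤ.* + 1) (sym (ℤ.*-identityʳ (+ n))))

ℕ→ℚ-mono-≤ : ∀ {m n} → m ℕ.≤ n → ℕ→ℚ m ≤ ℕ→ℚ n
ℕ→ℚ-mono-≤ {m} {n} m≤n rewrite ℕ→ℚ≡mkℚ m | ℕ→ℚ≡mkℚ n =
  *≤* (ℤ.*-monoʳ-≤-nonNeg (+ 1) (ℤ.+≤+ m≤n))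

0≤ℕ→ℚ : ∀ n → 0ℚ ≤ ℕ→ℚ n
0≤ℕ→ℚ n = ℕ→ℚ-mono-≤ {0} {n} ℕ.z≤n

ℕ→ℚ-*-/ℕ : ∀ n ⦃ _ : ℕ.NonZero n ⦄ q → ℕ→ℚ n * (q /ℕ n) ≡ q
ℕ→ℚ-*-/ℕ (ℕ.suc k) q
  rewrite ℕ→ℚ≡mkℚ (ℕ.suc k) | normalize-coprime {1} {k} (1-coprimeTo (ℕ.suc k)) = begin
    p * (q * 1/ p) ≡⟨ x∙yz≈y∙xz p q (1/ p) ⟩
    q * (p * 1/ p) ≡⟨ cong (q *_) (*-inverseʳ p) ⟩
    q * 1ℚ         ≡⟨ *-identityʳ q ⟩
    q              ∎
  where
  open ≡-Reasoning
  p : ℚ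
  p = mkℚ (+ ℕ.suc k) 0 (coprime-sym (1-coprimeTo (ℕ.suc k)))

0<ℕ→ℚ : ∀ n ⦃ _ : ℕ.NonZero n ⦄ → 0ℚ < ℕ→ℚ n
0<ℕ→ℚ n = <-≤-trans (positive⁻¹ 1ℚ) (ℕ→ℚ-mono-≤ (ℕ.>-nonZero⁻¹ n))

χ-∧ : ∀ b c → χ (b ∧ c) ≡ χ b * χ c
χ-∧ true  c = sym (*-identityˡ (χ c))
χ-∧ false c = sym (*-zeroˡ (χ c))

0≤χ : ∀ b → 0ℚ ≤ χ b
0≤χ true  = 0≤1
0≤χ false = ≤-refl

χ≤1 : ∀ b → χ b ≤ 1ℚ
χ≤1 true  = ≤-refl
χ≤1 false = 0≤1

module ∑ℚ = SemiringSum (CommutativeRing.semiring +-*-commutativeRing)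

∑≡sum : ∀ {n} (f : Fin n → ℚ) → ∑ n f ≡ ∑ℚ.sum f
∑≡sum {ℕ.zero}  f = refl
∑≡sum {ℕ.suc n} f = cong (λ s → f zero + s) (∑≡sum (λ i → f (suc i)))

∑-cong : ∀ {n} {f g : Fin n → ℚ} → (∀ i → f i ≡ g i) → ∑ n f ≡ ∑ n g
∑-cong {ℕ.zero}  f≗g = refl
∑-cong {ℕ.suc n} f≗g = cong₂ _+_ (f≗g zero) (∑-cong (λ i → f≗g (suc i)))

∑-zero : ∀ n → ∑ n (λ _ → 0ℚ) ≡ 0ℚ
∑-zero n = trans (∑≡sum {n} (λ _ → 0ℚ)) (∑ℚ.sum-replicate-zero n)

∑-distrib-+ : ∀ {n} (f g : Fin n → ℚ) → ∑ n (λ i → f i + g i) ≡ ∑ n f + ∑ n g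
∑-distrib-+ f g =
  trans (∑≡sum (λ i → f i + g i)) (trans (∑ℚ.∑-distrib-+ f g) (sym (cong₂ _+_ (∑≡sum f) (∑≡sum g))))

*-distribˡ-∑ : ∀ {n} c (f : Fin n → ℚ) → c * ∑ n f ≡ ∑ n (λ i → c * f i)
*-distribˡ-∑ c f =
  trans (cong (c *_) (∑≡sum f)) (trans (∑ℚ.*-distribˡ-sum c f) (sym (∑≡sum (λ i → c * f i))))

*-distribʳ-∑ : ∀ {n} c (f : Fin n → ℚ) → ∑ n f * c ≡ ∑ n (λ i → f i * c)
*-distribʳ-∑ c f =
  trans (cong (_* c) (∑≡sum f)) (trans (∑ℚ.*-distribʳ-sum c f) (sym (∑≡sum (λ i → f i * c))))

∑-comm : ∀ {m n} (F : Fin m → Fin n → ℚ) →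
         ∑ m (λ x → ∑ n (λ y → F x y)) ≡ ∑ n (λ y → ∑ m (λ x → F x y))
∑-comm {m} {n} F = begin
  ∑ m (λ x → ∑ n (F x))                  ≡⟨ ∑-cong (λ x → ∑≡sum (F x)) ⟩
  ∑ m (λ x → ∑ℚ.sum (F x))               ≡⟨ ∑≡sum (λ x → ∑ℚ.sum (F x)) ⟩
  ∑ℚ.sum (λ x → ∑ℚ.sum (F x))            ≡⟨ ∑ℚ.∑-comm F ⟩
  ∑ℚ.sum (λ y → ∑ℚ.sum (λ x → F x y))    ≡⟨ sym (∑≡sum (λ y → ∑ℚ.sum (λ x → F x y))) ⟩
  ∑ n (λ y → ∑ℚ.sum (λ x → F x y))       ≡⟨ ∑-cong (λ y → sym (∑≡sum (λ x → F x y))) ⟩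
  ∑ n (λ y → ∑ m (λ x → F x y))          ∎
  where open ≡-Reasoning

∑-neg : ∀ {n} (f : Fin n → ℚ) → ∑ n (λ i → - f i) ≡ - ∑ n f
∑-neg {ℕ.zero}  f = refl
∑-neg {ℕ.suc n} f =
  trans (cong (λ s → - f zero + s) (∑-neg (λ i → f (suc i)))) (sym (neg-distrib-+ (f zero) _))

∑-distrib-- : ∀ {n} (f g : Fin n → ℚ) → ∑ n (λ i → f i - g i) ≡ ∑ n f - ∑ n g
∑-distrib-- {n} f g = trans (∑-distrib-+ f (λ i → - g i)) (cong (λ s → ∑ n f + s) (∑-neg g))

∑-mono-≤ : ∀ {n} {f g : Fin n → ℚ} → (∀ i → f i ≤ g i) → ∑ n f ≤ ∑ n g
∑-mono-≤ {ℕ.zero}  f≤g = ≤-refl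
∑-mono-≤ {ℕ.suc n} f≤g = +-mono-≤ (f≤g zero) (∑-mono-≤ (λ i → f≤g (suc i)))

∣∑∣≤∑∣∣ : ∀ {n} (f : Fin n → ℚ) → abs (∑ n f) ≤ ∑ n (λ i → abs (f i))
∣∑∣≤∑∣∣ {ℕ.zero}  f = ≤-refl
∣∑∣≤∑∣∣ {ℕ.suc n} f =
  ≤-trans (∣p+q∣≤∣p∣+∣q∣ (f zero) _) (+-monoʳ-≤ (abs (f zero)) (∣∑∣≤∑∣∣ (λ i → f (suc i))))

∑<∑⇒∃< : ∀ {n} (f g : Fin n → ℚ) → ∑ n f < ∑ n g → ∃ λ i → f i < g i
∑<∑⇒∃< {ℕ.zero}  f g 0<0 = contradiction 0<0 (<-irrefl refl)
∑<∑⇒∃< {ℕ.suc n} f g ∑f<∑g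
  with f zero <? g zero | ∑ n (λ i → f (suc i)) <? ∑ n (λ i → g (suc i))
... | yes f₀<g₀ | _        = zero , f₀<g₀
... | no  _     | yes ∑<∑′ =
  let i , fᵢ<gᵢ = ∑<∑⇒∃< (λ i → f (suc i)) (λ i → g (suc i)) ∑<∑′ in suc i , fᵢ<gᵢ
... | no  f₀≮g₀ | no  ∑≮∑′ =
  contradiction (<-≤-trans ∑f<∑g (+-mono-≤ (≮⇒≥ f₀≮g₀) (≮⇒≥ ∑≮∑′))) (<-irrefl refl)

𝟙 : ∀ {n} → Subset n → Fin n → ℚ
𝟙 S i = χ (lookup S i)

∑∈ : ∀ {n} → Subset n → (Fin n → ℚ) → ℚ
∑∈ {n} S w = ∑ n (λ i → 𝟙 S i * w i)

syntax ∑∈ S (λ i → e) = ∑[ i ∈ S ] e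

module _ {n : ℕ} {S : Subset n} where

  ∈⇒𝟙≡1 : ∀ {i} → i ∈ S → 𝟙 S i ≡ 1ℚ
  ∈⇒𝟙≡1 i∈S = cong χ ([]=⇒lookup i∈S)

  ∉⇒𝟙≡0 : ∀ {i} → i ∉ S → 𝟙 S i ≡ 0ℚ
  ∉⇒𝟙≡0 {i} i∉S with lookup S i in S[i]
  ... | true  = contradiction (lookup⇒[]= i S S[i]) i∉S
  ... | false = refl

0≤𝟙 : ∀ {n} (S : Subset n) i → 0ℚ ≤ 𝟙 S i
0≤𝟙 S i = 0≤χ (lookup S i)

𝟙≤1 : ∀ {n} (S : Subset n) i → 𝟙 S i ≤ 1ℚ
𝟙≤1 S i = χ≤1 (lookup S i)

∣S∣≡∑𝟙 : ∀ {n} (S : Subset n) → ℕ→ℚ ∣ S ∣ ≡ ∑ n (𝟙 S)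
∣S∣≡∑𝟙 Vec.[]          = refl
∣S∣≡∑𝟙 (true  Vec.∷ S) = trans (ℕ→ℚ-suc ∣ S ∣) (cong (λ s → 1ℚ + s) (∣S∣≡∑𝟙 S))
∣S∣≡∑𝟙 (false Vec.∷ S) = trans (sym (+-identityˡ _)) (cong (λ s → 0ℚ + s) (∣S∣≡∑𝟙 S))

module _ {n : ℕ} (S : Subset n) where

  ∑∈-cong : ∀ {v w : Fin n → ℚ} → (∀ {i} → i ∈ S → v i ≡ w i) → ∑∈ S v ≡ ∑∈ S w
  ∑∈-cong {v} {w} v≡w = ∑-cong pointwise
    where
    pointwise : ∀ i → 𝟙 S i * v i ≡ 𝟙 S i * w i
    pointwise i with i ∈? S
    ... | yes i∈S = cong (𝟙 S i *_) (v≡w i∈S)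
    ... | no  i∉S rewrite ∉⇒𝟙≡0 i∉S = trans (*-zeroˡ (v i)) (sym (*-zeroˡ (w i)))

  ∑∈-const : ∀ c → ∑∈ S (λ _ → c) ≡ ℕ→ℚ ∣ S ∣ * c
  ∑∈-const c = trans (sym (*-distribʳ-∑ c (𝟙 S))) (cong (_* c) (sym (∣S∣≡∑𝟙 S)))

  ∑∈-distrib-- : ∀ (v w : Fin n → ℚ) → ∑∈ S (λ i → v i - w i) ≡ ∑∈ S v - ∑∈ S w
  ∑∈-distrib-- v w =
    trans (∑-cong (λ i → x[y-z]≈xy-xz (𝟙 S i) (v i) (w i))) (∑-distrib-- (λ i → 𝟙 S i * v i) _)

  *-distribˡ-∑∈ : ∀ c (w : Fin n → ℚ) → c * ∑∈ S w ≡ ∑∈ S (λ i → c * w i)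
  *-distribˡ-∑∈ c w = trans (*-distribˡ-∑ c (λ i → 𝟙 S i * w i)) (∑-cong (λ i → x∙yz≈y∙xz c (𝟙 S i) (w i)))

  ∑∈-mono-≤ : ∀ {v w : Fin n → ℚ} → (∀ i → v i ≤ w i) → ∑∈ S v ≤ ∑∈ S w
  ∑∈-mono-≤ v≤w = ∑-mono-≤ (λ i → *-monoˡ-≤-0≤ (0≤𝟙 S i) (v≤w i))

∑-∑∈-comm : ∀ {m n} {T : Subset n} (F : Fin m → Fin n → ℚ) →
            ∑ m (λ x → ∑[ y ∈ T ] F x y) ≡ ∑[ y ∈ T ] ∑ m (λ x → F x y)
∑-∑∈-comm {T = T} F =
  trans (∑-comm (λ x y → 𝟙 T y * F x y)) (∑-cong (λ y → sym (*-distribˡ-∑ (𝟙 T y) (λ x → F x y))))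

∑∈-comm : ∀ {m n} {S : Subset m} {T : Subset n} (F : Fin m → Fin n → ℚ) →
          ∑[ x ∈ S ] ∑[ y ∈ T ] F x y ≡ ∑[ y ∈ T ] ∑[ x ∈ S ] F x y
∑∈-comm {m} {S = S} {T} F = begin
  ∑[ x ∈ S ] ∑[ y ∈ T ] F x y             ≡⟨ ∑-cong (λ x → *-distribˡ-∑∈ T (𝟙 S x) (F x)) ⟩
  ∑ m (λ x → ∑[ y ∈ T ] (𝟙 S x * F x y)) ≡⟨ ∑-∑∈-comm {T = T} (λ x y → 𝟙 S x * F x y) ⟩
  ∑[ y ∈ T ] ∑[ x ∈ S ] F x y             ∎
  where open ≡-Reasoning

𝟙-∩∁ : ∀ {n} {E T : Subset n} → T ⊆ E → ∀ i → 𝟙 (E ∩ ∁ T) i ≡ 𝟙 E i - 𝟙 T i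
𝟙-∩∁ {E = E} {T} T⊆E i rewrite lookup-zipWith _∧_ i E (∁ T) | lookup-map i not T
  with lookup T i in T[i]
... | true  rewrite []=⇒lookup (T⊆E (lookup⇒[]= i T T[i])) = refl
... | false rewrite ∧-identityʳ (lookup E i) = sym (+-identityʳ (𝟙 E i))

module _ {n : ℕ} {E T : Subset n} (T⊆E : T ⊆ E) where

  ∑∈-∩∁ : ∀ (w : Fin n → ℚ) → ∑∈ (E ∩ ∁ T) w ≡ ∑∈ E w - ∑∈ T w
  ∑∈-∩∁ w = begin
    ∑ n (λ i → 𝟙 (E ∩ ∁ T) i * w i)         ≡⟨ ∑-cong (λ i → cong (_* w i) (𝟙-∩∁ T⊆E i)) ⟩
    ∑ n (λ i → (𝟙 E i - 𝟙 T i) * w i)       ≡⟨ ∑-cong (λ i → [y-z]x≈yx-zx (w i) (𝟙 E i) (𝟙 T i)) ⟩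
    ∑ n (λ i → 𝟙 E i * w i - 𝟙 T i * w i)   ≡⟨ ∑-distrib-- (λ i → 𝟙 E i * w i) _ ⟩
    ∑∈ E w - ∑∈ T w                         ∎
    where open ≡-Reasoning

  ∣E∩∁T∣≡∣E∣-∣T∣ : ℕ→ℚ ∣ E ∩ ∁ T ∣ ≡ (ℕ→ℚ ∣ E ∣) - (ℕ→ℚ ∣ T ∣)
  ∣E∩∁T∣≡∣E∣-∣T∣ = begin
    ℕ→ℚ ∣ E ∩ ∁ T ∣             ≡⟨ ∣S∣≡∑𝟙 (E ∩ ∁ T) ⟩
    ∑ n (𝟙 (E ∩ ∁ T))           ≡⟨ ∑-cong (𝟙-∩∁ T⊆E) ⟩
    ∑ n (λ i → 𝟙 E i - 𝟙 T i)   ≡⟨ ∑-distrib-- (𝟙 E) (𝟙 T) ⟩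
    ∑ n (𝟙 E) - ∑ n (𝟙 T)       ≡⟨ sym (cong₂ _-_ (∣S∣≡∑𝟙 E) (∣S∣≡∑𝟙 T)) ⟩
    (ℕ→ℚ ∣ E ∣) - (ℕ→ℚ ∣ T ∣)   ∎
    where open ≡-Reasoning

𝟙*𝟙≡𝟙 : ∀ {n} (S : Subset n) i → 𝟙 S i * 𝟙 S i ≡ 𝟙 S i
𝟙*𝟙≡𝟙 S i with lookup S i
... | true  = refl
... | false = refl

nonempty⇒nonZero : ∀ {n} {S : Subset n} → Nonempty S → ℕ.NonZero ∣ S ∣
nonempty⇒nonZero {S = S} (x , x∈S) = ℕ.>-nonZero (subst (ℕ._≤ ∣ S ∣) (∣⁅x⁆∣≡1 x) (p⊆q⇒∣p∣≤∣q∣ ⁅x⁆⊆S))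
  where
  ⁅x⁆⊆S : ⁅ x ⁆ ⊆ S
  ⁅x⁆⊆S y∈⁅x⁆ = subst (_∈ S) (sym (x∈⁅y⁆⇒x≡y x y∈⁅x⁆)) x∈S

positives : ∀ {n} → (Fin n → ℚ) → Subset n
positives w = tabulate (λ i → does (0ℚ <? w i))

module _ {n : ℕ} (w : Fin n → ℚ) where

  ∑∈positives≡∑⁺ : ∑∈ (positives w) w ≡ ∑ n (λ i → w i ⁺)
  ∑∈positives≡∑⁺ = ∑-cong (λ i → cong (λ b → χ b * w i) (lookup∘tabulate _ i))

  ∈positives⇒0< : ∀ {i} → i ∈ positives w → 0ℚ < w i
  ∈positives⇒0< {i} i∈P = by-sign (0ℚ <? w i) (trans (sym (lookup∘tabulate _ i)) ([]=⇒lookup i∈P))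
    where
    by-sign : (0<wᵢ? : Dec (0ℚ < w i)) → does 0<wᵢ? ≡ true → 0ℚ < w i
    by-sign (yes 0<wᵢ) _ = 0<wᵢ

  positives-⊆ : ∀ {E} → (∀ {i} → i ∉ E → w i ≡ 0ℚ) → positives w ⊆ E
  positives-⊆ {E} w-vanishes {i} i∈P with i ∈? E
  ... | yes i∈E = i∈E
  ... | no  i∉E = contradiction (subst (0ℚ <_) (w-vanishes i∉E) (∈positives⇒0< i∈P)) (<-irrefl refl)

  ∑≡0⇒∑∈positives≡½∑∣∣ : ∑ n w ≡ 0ℚ → ∑∈ (positives w) w ≡ ∑ n (λ i → abs (w i)) * ½
  ∑≡0⇒∑∈positives≡½∑∣∣ ∑w≡0 = begin
    ∑∈ (positives w) w                          ≡⟨ ∑∈positives≡∑⁺ ⟩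
    ∑ n (λ i → w i ⁺)                           ≡⟨ sym ([p+p]*½≡p _) ⟩
    (∑ n (λ i → w i ⁺) + ∑ n (λ i → w i ⁺)) * ½ ≡⟨ cong (_* ½) (sym ∑∣w∣≡∑⁺+∑⁺) ⟩
    ∑ n (λ i → abs (w i)) * ½                   ∎
    where
    open ≡-Reasoning
    ∑∣w∣≡∑⁺+∑⁺ : ∑ n (λ i → abs (w i)) ≡ ∑ n (λ i → w i ⁺) + ∑ n (λ i → w i ⁺)
    ∑∣w∣≡∑⁺+∑⁺ = begin
      ∑ n (λ i → abs (w i))                     ≡⟨ sym (+-identityʳ _) ⟩
      ∑ n (λ i → abs (w i)) + 0ℚ                ≡⟨ cong (λ s → ∑ n (λ i → abs (w i)) + s) (sym ∑w≡0) ⟩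
      ∑ n (λ i → abs (w i)) + ∑ n w             ≡⟨ sym (∑-distrib-+ (λ i → abs (w i)) w) ⟩
      ∑ n (λ i → abs (w i) + w i)               ≡⟨ ∑-cong (λ i → ∣p∣+p≡p⁺+p⁺ (w i)) ⟩
      ∑ n (λ i → w i ⁺ + w i ⁺)                 ≡⟨ ∑-distrib-+ (λ i → w i ⁺) (λ i → w i ⁺) ⟩
      ∑ n (λ i → w i ⁺) + ∑ n (λ i → w i ⁺)     ∎

∃-above-average : ∀ {n} {E : Subset n} {w : Fin n → ℚ} t → (∀ {i} → i ∉ E → w i ≡ 0ℚ) →
                  ℕ→ℚ ∣ E ∣ * t < ∑ n w → ∃ λ i → t < w i
∃-above-average {n} {E} {w} t w-vanishes ∣E∣t<∑w
  with ∑<∑⇒∃< (λ i → 𝟙 E i * t) w (subst (_< ∑ n w) (sym (∑∈-const E t)) ∣E∣t<∑w)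
... | i , 𝟙ᵢt<wᵢ with i ∈? E
...   | yes i∈E = i , subst (_< w i) (trans (cong (_* t) (∈⇒𝟙≡1 i∈E)) (*-identityˡ t)) 𝟙ᵢt<wᵢ
...   | no  i∉E = contradiction
  (subst₂ _<_ (trans (cong (_* t) (∉⇒𝟙≡0 i∉E)) (*-zeroˡ t)) (w-vanishes i∉E) 𝟙ᵢt<wᵢ) (<-irrefl refl)

module _ {m n : ℕ} (F : Fin m → Fin n → ℚ) where

  ∑∈-bilinear-≤ : ∀ (b : Fin m → ℚ) (T : Subset n) → (∀ x → abs (b x) ≤ 1ℚ) →
                  ∑[ y ∈ T ] ∑ m (λ x → b x * F x y) ≤ ∑ m (λ x → abs (∑[ y ∈ T ] F x y))
  ∑∈-bilinear-≤ b T ∣b∣≤1 = begin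
    ∑[ y ∈ T ] ∑ m (λ x → b x * F x y)   ≡⟨ sym (∑-∑∈-comm {T = T} (λ x y → b x * F x y)) ⟩
    ∑ m (λ x → ∑[ y ∈ T ] (b x * F x y)) ≡⟨ ∑-cong (λ x → sym (*-distribˡ-∑∈ T (b x) (F x))) ⟩
    ∑ m (λ x → b x * ∑[ y ∈ T ] F x y)   ≤⟨ ∑-mono-≤ (λ x → ∣p∣≤1⇒p*q≤∣q∣ _ (∣b∣≤1 x)) ⟩
    ∑ m (λ x → abs (∑[ y ∈ T ] F x y))   ∎
    where open ≤-Reasoning

  sign-split : ∀ (b : Fin m → ℚ) {E : Subset n} → (∀ x → abs (b x) ≤ 1ℚ) →
               (∀ x {y} → y ∉ E → F x y ≡ 0ℚ) →
               ∃ λ T → T ⊆ E ×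
                 ∑ n (λ y → abs (∑ m (λ x → b x * F x y))) * ½ ≤ ∑ m (λ x → abs (∑[ y ∈ T ] F x y))
  sign-split b {E} ∣b∣≤1 F-vanishes = larger (≤-total (P -b) (P b))
    where
    u : (Fin m → ℚ) → Fin n → ℚ
    u c y = ∑ m (λ x → c x * F x y)

    P : (Fin m → ℚ) → ℚ
    P c = ∑∈ (positives (u c)) (u c)

    V : Subset n → ℚ
    V T = ∑ m (λ x → abs (∑[ y ∈ T ] F x y))

    -b : Fin m → ℚ
    -b x = - b x

    ∣-b∣≤1 : ∀ x → abs (-b x) ≤ 1ℚ
    ∣-b∣≤1 x = subst (_≤ 1ℚ) (sym (∣-p∣≡∣p∣ (b x))) (∣b∣≤1 x)

    -u≡u-b : ∀ y → - u b y ≡ u -b y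
    -u≡u-b y = trans (sym (∑-neg (λ x → b x * F x y))) (∑-cong (λ x → neg-distribˡ-* (b x) (F x y)))

    ∑∣u∣≡P+P : ∑ n (λ y → abs (u b y)) ≡ P b + P -b
    ∑∣u∣≡P+P = begin
      ∑ n (λ y → abs (u b y))                   ≡⟨ ∑-cong (λ y → ∣p∣≡p⁺+[-p]⁺ (u b y)) ⟩
      ∑ n (λ y → u b y ⁺ + (- u b y) ⁺)         ≡⟨ ∑-distrib-+ (λ y → u b y ⁺) _ ⟩
      ∑ n (λ y → u b y ⁺) + ∑ n (λ y → (- u b y) ⁺)
        ≡⟨ cong (λ s → ∑ n (λ y → u b y ⁺) + s) (∑-cong (λ y → cong _⁺ (-u≡u-b y))) ⟩
      ∑ n (λ y → u b y ⁺) + ∑ n (λ y → u -b y ⁺)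
        ≡⟨ sym (cong₂ _+_ (∑∈positives≡∑⁺ (u b)) (∑∈positives≡∑⁺ (u -b))) ⟩
      P b + P -b                                ∎
      where open ≡-Reasoning

    positives-u⊆E : ∀ c → positives (u c) ⊆ E
    positives-u⊆E c = positives-⊆ (u c) λ y∉E →
      trans (∑-cong (λ x → trans (cong (c x *_) (F-vanishes x y∉E)) (*-zeroʳ (c x)))) (∑-zero m)

    larger : P -b ≤ P b ⊎ P b ≤ P -b →
             ∃ λ T → T ⊆ E × ∑ n (λ y → abs (u b y)) * ½ ≤ V T
    larger (inj₁ P-b≤Pb) = positives (u b) , positives-u⊆E b , (begin
      ∑ n (λ y → abs (u b y)) * ½   ≡⟨ cong (_* ½) ∑∣u∣≡P+P ⟩
      (P b + P -b) * ½              ≤⟨ [p+q]*½≤p P-b≤Pb ⟩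
      P b                           ≤⟨ ∑∈-bilinear-≤ b (positives (u b)) ∣b∣≤1 ⟩
      V (positives (u b))           ∎)
      where open ≤-Reasoning
    larger (inj₂ Pb≤P-b) = positives (u -b) , positives-u⊆E -b , (begin
      ∑ n (λ y → abs (u b y)) * ½   ≡⟨ cong (_* ½) (trans ∑∣u∣≡P+P (+-comm (P b) (P -b))) ⟩
      (P -b + P b) * ½              ≤⟨ [p+q]*½≤p Pb≤P-b ⟩
      P -b                          ≤⟨ ∑∈-bilinear-≤ -b (positives (u -b)) ∣-b∣≤1 ⟩
      V (positives (u -b))          ∎)
      where open ≤-Reasoning

-- For F the balanced function, energy is the left-hand side of the α-uniformity condition.
module Gram {m n : ℕ} (F : Fin m → Fin n → ℚ) {E₁ : Subset m} {E₂ : Subset n}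
            (∣F∣≤𝟙𝟙 : ∀ x y → abs (F x y) ≤ 𝟙 E₁ x * 𝟙 E₂ y)
            (F-columns : ∀ y → ∑ m (λ x → F x y) ≡ 0ℚ) where

  n₁ n₂ : ℚ
  n₁ = ℕ→ℚ ∣ E₁ ∣
  n₂ = ℕ→ℚ ∣ E₂ ∣

  gram : Fin n → Fin n → ℚ
  gram y y′ = ∑ m (λ x → F x y * F x y′)

  energy : ℚ
  energy = ∑ n (λ y → ∑ n (λ y′ → gram y y′ ^ℚ 2))

  mass : ℚ
  mass = ∑ n (λ y → ∑ n (λ y′ → abs (gram y y′)))

  F-vanishes₁ : ∀ {x} y → x ∉ E₁ → F x y ≡ 0ℚ
  F-vanishes₁ {x} y x∉E₁ = ∣p∣≤0⇒p≡0
    (subst (abs (F x y) ≤_) (trans (cong (_* 𝟙 E₂ y) (∉⇒𝟙≡0 x∉E₁)) (*-zeroˡ (𝟙 E₂ y))) (∣F∣≤𝟙𝟙 x y))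

  F-vanishes₂ : ∀ x {y} → y ∉ E₂ → F x y ≡ 0ℚ
  F-vanishes₂ x {y} y∉E₂ = ∣p∣≤0⇒p≡0
    (subst (abs (F x y) ≤_) (trans (cong (𝟙 E₁ x *_) (∉⇒𝟙≡0 y∉E₂)) (*-zeroʳ (𝟙 E₁ x))) (∣F∣≤𝟙𝟙 x y))

  ∣F∣≤1 : ∀ x y → abs (F x y) ≤ 1ℚ
  ∣F∣≤1 x y = ≤-trans (∣F∣≤𝟙𝟙 x y) (*-mono-≤-0≤ (0≤𝟙 E₁ x) (0≤𝟙 E₂ y) (𝟙≤1 E₁ x) (𝟙≤1 E₂ y))

  ∣gram∣≤ : ∀ y y′ → abs (gram y y′) ≤ n₁ * (𝟙 E₂ y * 𝟙 E₂ y′)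
  ∣gram∣≤ y y′ = begin
    abs (gram y y′)
      ≤⟨ ∣∑∣≤∑∣∣ (λ x → F x y * F x y′) ⟩
    ∑ m (λ x → abs (F x y * F x y′))
      ≡⟨ ∑-cong (λ x → ∣p*q∣≡∣p∣*∣q∣ (F x y) (F x y′)) ⟩
    ∑ m (λ x → abs (F x y) * abs (F x y′))
      ≤⟨ ∑-mono-≤ (λ x → *-mono-≤-0≤ (0≤∣p∣ _) (0≤∣p∣ _) (∣F∣≤𝟙𝟙 x y) (∣F∣≤𝟙𝟙 x y′)) ⟩
    ∑ m (λ x → (𝟙 E₁ x * 𝟙 E₂ y) * (𝟙 E₁ x * 𝟙 E₂ y′))
      ≡⟨ ∑-cong (λ x → trans (ab*ac≡aa*bc (𝟙 E₁ x) (𝟙 E₂ y) (𝟙 E₂ y′)) (cong (_* _) (𝟙*𝟙≡𝟙 E₁ x))) ⟩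
    ∑[ x ∈ E₁ ] (𝟙 E₂ y * 𝟙 E₂ y′)
      ≡⟨ ∑∈-const E₁ _ ⟩
    n₁ * (𝟙 E₂ y * 𝟙 E₂ y′)
      ∎
    where
    open ≤-Reasoning
    ab*ac≡aa*bc : ∀ a b c → (a * b) * (a * c) ≡ (a * a) * (b * c)
    ab*ac≡aa*bc = solve-∀ ℚ-ring

  energy≤n₁*mass : energy ≤ n₁ * mass
  energy≤n₁*mass = begin
    energy
      ≤⟨ ∑-mono-≤ (λ y → ∑-mono-≤ (λ y′ → ∣p∣≤q⇒p²≤q*∣p∣ (≤-trans (∣gram∣≤ y y′) (n₁*𝟙𝟙≤n₁ y y′)))) ⟩
    ∑ n (λ y → ∑ n (λ y′ → n₁ * abs (gram y y′)))
      ≡⟨ ∑-cong (λ y → sym (*-distribˡ-∑ n₁ (λ y′ → abs (gram y y′)))) ⟩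
    ∑ n (λ y → n₁ * ∑ n (λ y′ → abs (gram y y′)))
      ≡⟨ sym (*-distribˡ-∑ n₁ (λ y → ∑ n (λ y′ → abs (gram y y′)))) ⟩
    n₁ * mass
      ∎
    where
    open ≤-Reasoning
    n₁*𝟙𝟙≤n₁ : ∀ y y′ → n₁ * (𝟙 E₂ y * 𝟙 E₂ y′) ≤ n₁
    n₁*𝟙𝟙≤n₁ y y′ = subst (n₁ * (𝟙 E₂ y * 𝟙 E₂ y′) ≤_) (*-identityʳ n₁) (*-monoˡ-≤-0≤ (0≤ℕ→ℚ ∣ E₁ ∣)
      (*-mono-≤-0≤ (0≤𝟙 E₂ y) (0≤𝟙 E₂ y′) (𝟙≤1 E₂ y) (𝟙≤1 E₂ y′)))

  mass≤n₁n₂n₂ : mass ≤ n₁ * (n₂ * n₂)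
  mass≤n₁n₂n₂ = begin
    mass
      ≤⟨ ∑-mono-≤ (λ y → ∑-mono-≤ (∣gram∣≤ y)) ⟩
    ∑ n (λ y → ∑ n (λ y′ → n₁ * (𝟙 E₂ y * 𝟙 E₂ y′)))
      ≡⟨ ∑-cong (λ y → ∑-cong (λ y′ → a*[b*c]≡c*[a*b] n₁ (𝟙 E₂ y) (𝟙 E₂ y′))) ⟩
    ∑ n (λ y → ∑[ y′ ∈ E₂ ] (n₁ * 𝟙 E₂ y))
      ≡⟨ ∑-cong (λ y → ∑∈-const E₂ (n₁ * 𝟙 E₂ y)) ⟩
    ∑ n (λ y → n₂ * (n₁ * 𝟙 E₂ y))
      ≡⟨ ∑-cong (λ y → a*[b*c]≡c*[a*b] n₂ n₁ (𝟙 E₂ y)) ⟩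
    ∑[ y ∈ E₂ ] (n₂ * n₁)
      ≡⟨ ∑∈-const E₂ (n₂ * n₁) ⟩
    n₂ * (n₂ * n₁)
      ≡⟨ a*[a*b]≡b*[a*a] n₂ n₁ ⟩
    n₁ * (n₂ * n₂)
      ∎
    where
    open ≤-Reasoning
    a*[b*c]≡c*[a*b] : ∀ a b c → a * (b * c) ≡ c * (a * b)
    a*[b*c]≡c*[a*b] = solve-∀ ℚ-ring
    a*[a*b]≡b*[a*a] : ∀ a b → a * (a * b) ≡ b * (a * a)
    a*[a*b]≡b*[a*a] = solve-∀ ℚ-ring

  M : ℚ
  M = (n₁ ^ℚ 2) * (n₂ ^ℚ 2)

  energy≤M : energy ≤ M
  energy≤M = begin
    energy                ≤⟨ energy≤n₁*mass ⟩
    n₁ * mass             ≤⟨ *-monoˡ-≤-0≤ (0≤ℕ→ℚ ∣ E₁ ∣) mass≤n₁n₂n₂ ⟩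
    n₁ * (n₁ * (n₂ * n₂)) ≡⟨ a[a[bb]]≡a²b² n₁ n₂ ⟩
    M                     ∎
    where
    open ≤-Reasoning
    a[a[bb]]≡a²b² : ∀ a b → a * (a * (b * b)) ≡ (a * (a * 1ℚ)) * (b * (b * 1ℚ))
    a[a[bb]]≡a²b² = solve-∀ ℚ-ring

  large-energy⇒α<1 : ∀ α → α * M < energy → α < 1ℚ
  large-energy⇒α<1 α αM<energy = *-cancelʳ-<-0≤ 0≤M
    (<-≤-trans αM<energy (subst (energy ≤_) (sym (*-identityˡ M)) energy≤M))
    where
    0≤M : 0ℚ ≤ M
    0≤M = *-preserves-0≤ (0≤p² n₁) (0≤p² n₂)

  row-mass : Fin n → ℚ
  row-mass y = ∑ n (λ y′ → abs (gram y y′))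

  row-mass-vanishes : ∀ {y} → y ∉ E₂ → row-mass y ≡ 0ℚ
  row-mass-vanishes {y} y∉E₂ = trans (∑-cong gram≡0) (∑-zero n)
    where
    gram≡0 : ∀ y′ → abs (gram y y′) ≡ 0ℚ
    gram≡0 y′ = cong abs (trans (∑-cong F₀F≡0) (∑-zero m))
      where
      F₀F≡0 : ∀ x → F x y * F x y′ ≡ 0ℚ
      F₀F≡0 x = trans (cong (_* F x y′) (F-vanishes₂ x y∉E₂)) (*-zeroˡ (F x y′))

  slice : Subset n → Fin m → ℚ
  slice T x = ∑[ y ∈ T ] F x y

  ∑slice≡0 : ∀ T → ∑ m (slice T) ≡ 0ℚ
  ∑slice≡0 T = begin
    ∑ m (slice T)                    ≡⟨ ∑-∑∈-comm {T = T} F ⟩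
    ∑[ y ∈ T ] ∑ m (λ x → F x y)     ≡⟨ ∑∈-cong T (λ {y} _ → F-columns y) ⟩
    ∑[ y ∈ T ] 0ℚ                    ≡⟨ ∑∈-const T 0ℚ ⟩
    ℕ→ℚ ∣ T ∣ * 0ℚ                   ≡⟨ *-zeroʳ (ℕ→ℚ ∣ T ∣) ⟩
    0ℚ                               ∎
    where open ≡-Reasoning

  slice-vanishes : ∀ T {x} → x ∉ E₁ → slice T x ≡ 0ℚ
  slice-vanishes T x∉E₁ =
    trans (∑∈-cong T (λ {y} _ → F-vanishes₁ y x∉E₁)) (trans (∑∈-const T 0ℚ) (*-zeroʳ (ℕ→ℚ ∣ T ∣)))

  large-energy⇒large-mass : ∀ α → α * M < energy → n₂ * (α * (n₁ * n₂)) < mass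
  large-energy⇒large-mass α αM<energy = *-cancelˡ-<-0≤ (0≤ℕ→ℚ ∣ E₁ ∣) (begin-strict
    n₁ * (n₂ * (α * (n₁ * n₂))) ≡⟨ b[c[a[bc]]]≡a[b²c²] α n₁ n₂ ⟩
    α * M                       <⟨ αM<energy ⟩
    energy                      ≤⟨ energy≤n₁*mass ⟩
    n₁ * mass                   ∎)
    where
    open ≤-Reasoning
    b[c[a[bc]]]≡a[b²c²] : ∀ a b c → b * (c * (a * (b * c))) ≡ a * ((b * (b * 1ℚ)) * (c * (c * 1ℚ)))
    b[c[a[bc]]]≡a[b²c²] = solve-∀ ℚ-ring

  large-energy⇒rectangle : ∀ α → α * M < energy →
    ∃₂ λ S T → S ⊆ E₁ × T ⊆ E₂ × α * (n₁ * n₂) * ½ * ½ < ∑[ x ∈ S ] ∑[ y ∈ T ] F x y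
  large-energy⇒rectangle α αM<energy =
    let y₀ , αn₁n₂<row-mass = ∃-above-average {E = E₂} {w = row-mass} (α * (n₁ * n₂))
                                row-mass-vanishes (large-energy⇒large-mass α αM<energy)
        T , T⊆E₂ , row-mass*½≤∑∣slice∣ = sign-split F (λ x → F x y₀) {E = E₂} (λ x → ∣F∣≤1 x y₀) F-vanishes₂
    in positives (slice T) , T , positives-⊆ (slice T) (slice-vanishes T) , T⊆E₂ , (begin-strict
         α * (n₁ * n₂) * ½ * ½              <⟨ *-monoˡ-<-pos ½ (*-monoˡ-<-pos ½ αn₁n₂<row-mass) ⟩
         row-mass y₀ * ½ * ½                ≤⟨ *-monoʳ-≤-0≤ 0≤½ row-mass*½≤∑∣slice∣ ⟩
         ∑ m (λ x → abs (slice T x)) * ½    ≡⟨ sym (∑≡0⇒∑∈positives≡½∑∣∣ (slice T) (∑slice≡0 T)) ⟩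
         ∑∈ (positives (slice T)) (slice T) ∎)
    where open ≤-Reasoning

cardIn≡∑∈∑∈ : ∀ {N} (A : Rel N) (G₁ G₂ : Subset N) →
              cardIn A G₁ G₂ ≡ ∑[ x ∈ G₁ ] ∑[ y ∈ G₂ ] χ (A x y)
cardIn≡∑∈∑∈ {N} A G₁ G₂ = ∑-cong λ x → begin
  ∑ N (λ y → χ (A x y ∧ (lookup G₁ x ∧ lookup G₂ y)))
    ≡⟨ ∑-cong (λ y → χ-∧∧ (A x y) (lookup G₁ x) (lookup G₂ y)) ⟩
  ∑ N (λ y → 𝟙 G₁ x * (𝟙 G₂ y * χ (A x y)))
    ≡⟨ sym (*-distribˡ-∑ (𝟙 G₁ x) (λ y → 𝟙 G₂ y * χ (A x y))) ⟩
  𝟙 G₁ x * ∑[ y ∈ G₂ ] χ (A x y)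
    ∎
  where
  open ≡-Reasoning
  χ-∧∧ : ∀ a b c → χ (a ∧ (b ∧ c)) ≡ χ b * (χ c * χ a)
  χ-∧∧ a b c = trans (χ-∧ a (b ∧ c)) (trans (cong (χ a *_) (χ-∧ b c)) (a[bc]≡b[ca] (χ a) (χ b) (χ c)))
    where
    a[bc]≡b[ca] : ∀ a b c → a * (b * c) ≡ b * (c * a)
    a[bc]≡b[ca] = solve-∀ ℚ-ring

cardIn≤∣G₁∣∣G₂∣ : ∀ {N} (A : Rel N) (G₁ G₂ : Subset N) → cardIn A G₁ G₂ ≤ ℕ→ℚ ∣ G₁ ∣ * ℕ→ℚ ∣ G₂ ∣
cardIn≤∣G₁∣∣G₂∣ A G₁ G₂ = begin
  cardIn A G₁ G₂                       ≡⟨ cardIn≡∑∈∑∈ A G₁ G₂ ⟩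
  ∑[ x ∈ G₁ ] ∑[ y ∈ G₂ ] χ (A x y)    ≤⟨ ∑∈-mono-≤ G₁ (λ x → ∑∈-mono-≤ G₂ (λ y → χ≤1 (A x y))) ⟩
  ∑[ x ∈ G₁ ] ∑[ y ∈ G₂ ] 1ℚ           ≡⟨ ∑∈-cong G₁ (λ _ → trans (∑∈-const G₂ 1ℚ) (*-identityʳ _)) ⟩
  ∑[ x ∈ G₁ ] ℕ→ℚ ∣ G₂ ∣               ≡⟨ ∑∈-const G₁ (ℕ→ℚ ∣ G₂ ∣) ⟩
  ℕ→ℚ ∣ G₁ ∣ * ℕ→ℚ ∣ G₂ ∣              ∎
  where open ≤-Reasoning

0≤density : ∀ {N} (A : Rel N) {δ p} → 0ℚ < p → card A ≡ δ * p → 0ℚ ≤ δ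
0≤density {N} A {δ} {p} 0<p ∣A∣≡δp = *-cancelʳ-≤-pos p ⦃ positive 0<p ⦄ (begin
  0ℚ * p                          ≡⟨ *-zeroˡ p ⟩
  0ℚ                              ≡⟨ sym (trans (∑-cong {N} (λ _ → ∑-zero N)) (∑-zero N)) ⟩
  ∑ N (λ x → ∑ N (λ y → 0ℚ))      ≤⟨ ∑-mono-≤ (λ x → ∑-mono-≤ (λ y → 0≤χ (A x y))) ⟩
  card A                          ≡⟨ ∣A∣≡δp ⟩
  δ * p                           ∎)
  where open ≤-Reasoning

increment-on-rectangle : ∀ {η δ s t n₁ n₂ C D} → 0ℚ ≤ η → 0ℚ ≤ s → s ≤ n₁ → 0ℚ ≤ n₂ →
                         (η + η) * (n₁ * n₂) < C - s * D → δ * t - η * n₂ ≤ D →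
                         δ * (s * t) + η * (n₁ * n₂) < C
increment-on-rectangle {η} {δ} {s} {t} {n₁} {n₂} {C} {D} 0≤η 0≤s s≤n₁ 0≤n₂ 2ηn₁n₂<C-sD δt-ηn₂≤D =
  begin-strict
  δ * (s * t) + η * (n₁ * n₂)                  ≡⟨ solve (η ∷ δ ∷ s ∷ t ∷ n₁ ∷ n₂ ∷ []) ℚ-ring ⟩
  (η + η) * (n₁ * n₂) + (δ * (s * t) - η * (n₁ * n₂))
    ≤⟨ +-monoʳ-≤ ((η + η) * (n₁ * n₂)) (+-monoʳ-≤ (δ * (s * t)) (neg-antimono-≤ ηsn₂≤ηn₁n₂)) ⟩
  (η + η) * (n₁ * n₂) + (δ * (s * t) - η * (s * n₂))
    ≡⟨ cong (λ u → (η + η) * (n₁ * n₂) + u) (solve (η ∷ δ ∷ s ∷ t ∷ n₂ ∷ []) ℚ-ring) ⟩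
  (η + η) * (n₁ * n₂) + s * (δ * t - η * n₂)   ≤⟨ +-monoʳ-≤ ((η + η) * (n₁ * n₂)) (*-monoˡ-≤-0≤ 0≤s δt-ηn₂≤D) ⟩
  (η + η) * (n₁ * n₂) + s * D                  <⟨ +-monoˡ-< (s * D) 2ηn₁n₂<C-sD ⟩
  C - s * D + s * D                            ≡⟨ solve (s ∷ C ∷ D ∷ []) ℚ-ring ⟩
  C                                            ∎
  where
  open ≤-Reasoning
  ηsn₂≤ηn₁n₂ : η * (s * n₂) ≤ η * (n₁ * n₂)
  ηsn₂≤ηn₁n₂ = *-monoˡ-≤-0≤ 0≤η (*-monoʳ-≤-0≤ 0≤n₂ s≤n₁)

increment-on-complement : ∀ {η δ t n₁ n₂ D} → 0ℚ < n₁ → D < δ * t - η * n₂ →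
                          δ * (n₁ * (n₂ - t)) + η * (n₁ * n₂) < δ * (n₁ * n₂) - n₁ * D
increment-on-complement {η} {δ} {t} {n₁} {n₂} {D} 0<n₁ D<δt-ηn₂ = begin-strict
  δ * (n₁ * (n₂ - t)) + η * (n₁ * n₂)     ≡⟨ solve (η ∷ δ ∷ t ∷ n₁ ∷ n₂ ∷ []) ℚ-ring ⟩
  δ * (n₁ * n₂) + n₁ * - (δ * t - η * n₂)
    <⟨ +-monoʳ-< (δ * (n₁ * n₂)) (*-monoʳ-<-0< 0<n₁ (neg-antimono-< D<δt-ηn₂)) ⟩
  δ * (n₁ * n₂) + n₁ * - D                ≡⟨ cong (λ u → δ * (n₁ * n₂) + u) (sym (neg-distribʳ-* n₁ D)) ⟩
  δ * (n₁ * n₂) - n₁ * D                  ∎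
  where open ≤-Reasoning

module Balanced {N : ℕ} (E₁ E₂ : Subset N) ⦃ _ : ℕ.NonZero ∣ E₁ ∣ ⦄ (A : Rel N) where

  n₁ n₂ : ℚ
  n₁ = ℕ→ℚ ∣ E₁ ∣
  n₂ = ℕ→ℚ ∣ E₂ ∣

  a : Fin N → Fin N → ℚ
  a x y = χ (A x y)

  d : Fin N → ℚ
  d = δ[ E₁ ] A

  f : Fin N → Fin N → ℚ
  f = balanced E₁ E₂ A

  0<n₁ : 0ℚ < n₁
  0<n₁ = 0<ℕ→ℚ ∣ E₁ ∣

  n₁*d≡∑∈a : ∀ y → n₁ * d y ≡ ∑[ x ∈ E₁ ] a x y
  n₁*d≡∑∈a y = trans (ℕ→ℚ-*-/ℕ ∣ E₁ ∣ _) (∑-cong (λ x → χ-∧ (lookup E₁ x) (A x y)))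

  0≤d : ∀ y → 0ℚ ≤ d y
  0≤d y = *-cancelˡ-≤-pos n₁ ⦃ positive 0<n₁ ⦄ (begin
    n₁ * 0ℚ               ≡⟨ *-zeroʳ n₁ ⟩
    0ℚ                    ≡⟨ sym (trans (∑∈-const E₁ 0ℚ) (*-zeroʳ n₁)) ⟩
    ∑[ x ∈ E₁ ] 0ℚ        ≤⟨ ∑∈-mono-≤ E₁ (λ x → 0≤χ (A x y)) ⟩
    ∑[ x ∈ E₁ ] a x y     ≡⟨ sym (n₁*d≡∑∈a y) ⟩
    n₁ * d y              ∎)
    where open ≤-Reasoning

  d≤1 : ∀ y → d y ≤ 1ℚ
  d≤1 y = *-cancelˡ-≤-pos n₁ ⦃ positive 0<n₁ ⦄ (begin
    n₁ * d y              ≡⟨ n₁*d≡∑∈a y ⟩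
    ∑[ x ∈ E₁ ] a x y     ≤⟨ ∑∈-mono-≤ E₁ (λ x → χ≤1 (A x y)) ⟩
    ∑[ x ∈ E₁ ] 1ℚ        ≡⟨ ∑∈-const E₁ 1ℚ ⟩
    n₁ * 1ℚ               ∎)
    where open ≤-Reasoning

  f≡[a-d]𝟙𝟙 : ∀ x y → f x y ≡ (a x y - d y) * (𝟙 E₁ x * 𝟙 E₂ y)
  f≡[a-d]𝟙𝟙 x y = cong ((a x y - d y) *_) (χ-∧ (lookup E₁ x) (lookup E₂ y))

  f-on-support : ∀ {x y} → x ∈ E₁ → y ∈ E₂ → f x y ≡ a x y - d y
  f-on-support {x} {y} x∈E₁ y∈E₂ =
    trans (f≡[a-d]𝟙𝟙 x y) (trans (cong₂ (λ p q → (a x y - d y) * (p * q)) (∈⇒𝟙≡1 x∈E₁) (∈⇒𝟙≡1 y∈E₂))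
                                (*-identityʳ _))

  ∣f∣≤𝟙𝟙 : ∀ x y → abs (f x y) ≤ 𝟙 E₁ x * 𝟙 E₂ y
  ∣f∣≤𝟙𝟙 x y = begin
    abs (f x y)                            ≡⟨ cong abs (f≡[a-d]𝟙𝟙 x y) ⟩
    abs ((a x y - d y) * 𝟙𝟙)               ≡⟨ ∣p*q∣≡∣p∣*∣q∣ (a x y - d y) 𝟙𝟙 ⟩
    abs (a x y - d y) * abs 𝟙𝟙             ≡⟨ cong (abs (a x y - d y) *_) (0≤p⇒∣p∣≡p 0≤𝟙𝟙) ⟩
    abs (a x y - d y) * 𝟙𝟙
      ≤⟨ *-monoʳ-≤-0≤ 0≤𝟙𝟙 (∣p-q∣≤1 (0≤χ (A x y)) (χ≤1 (A x y)) (0≤d y) (d≤1 y)) ⟩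
    1ℚ * 𝟙𝟙                                ≡⟨ *-identityˡ 𝟙𝟙 ⟩
    𝟙𝟙                                     ∎
    where
    open ≤-Reasoning
    𝟙𝟙 : ℚ
    𝟙𝟙 = 𝟙 E₁ x * 𝟙 E₂ y
    0≤𝟙𝟙 : 0ℚ ≤ 𝟙𝟙
    0≤𝟙𝟙 = *-preserves-0≤ (0≤𝟙 E₁ x) (0≤𝟙 E₂ y)

  f-columns : ∀ y → ∑ N (λ x → f x y) ≡ 0ℚ
  f-columns y = begin
    ∑ N (λ x → f x y)
      ≡⟨ ∑-cong (λ x → trans (f≡[a-d]𝟙𝟙 x y) (p[qr]≡r[qp] (a x y - d y) (𝟙 E₁ x) (𝟙 E₂ y))) ⟩
    ∑ N (λ x → 𝟙 E₂ y * (𝟙 E₁ x * (a x y - d y)))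
      ≡⟨ sym (*-distribˡ-∑ (𝟙 E₂ y) (λ x → 𝟙 E₁ x * (a x y - d y))) ⟩
    𝟙 E₂ y * ∑[ x ∈ E₁ ] (a x y - d y)
      ≡⟨ cong (𝟙 E₂ y *_) (∑∈-distrib-- E₁ (λ x → a x y) (λ _ → d y)) ⟩
    𝟙 E₂ y * (∑[ x ∈ E₁ ] a x y - ∑[ x ∈ E₁ ] d y)
      ≡⟨ cong₂ (λ s t → 𝟙 E₂ y * (s - t)) (sym (n₁*d≡∑∈a y)) (∑∈-const E₁ (d y)) ⟩
    𝟙 E₂ y * (n₁ * d y - n₁ * d y)
      ≡⟨ cong (𝟙 E₂ y *_) (+-inverseʳ (n₁ * d y)) ⟩
    𝟙 E₂ y * 0ℚ
      ≡⟨ *-zeroʳ (𝟙 E₂ y) ⟩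
    0ℚ
      ∎
    where
    open ≡-Reasoning
    p[qr]≡r[qp] : ∀ p q r → p * (q * r) ≡ r * (q * p)
    p[qr]≡r[qp] = solve-∀ ℚ-ring

  rectangle-sum : ∀ {S T} → S ⊆ E₁ → T ⊆ E₂ →
                  ∑[ x ∈ S ] ∑[ y ∈ T ] f x y ≡ cardIn A S T - ℕ→ℚ ∣ S ∣ * ∑∈ T d
  rectangle-sum {S} {T} S⊆E₁ T⊆E₂ = begin
    ∑[ x ∈ S ] ∑[ y ∈ T ] f x y
      ≡⟨ ∑∈-cong S (λ x∈S → ∑∈-cong T (λ y∈T → f-on-support (S⊆E₁ x∈S) (T⊆E₂ y∈T))) ⟩
    ∑[ x ∈ S ] ∑[ y ∈ T ] (a x y - d y)
      ≡⟨ ∑∈-cong S (λ {x} _ → ∑∈-distrib-- T (a x) d) ⟩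
    ∑[ x ∈ S ] (∑[ y ∈ T ] a x y - ∑∈ T d)
      ≡⟨ ∑∈-distrib-- S (λ x → ∑[ y ∈ T ] a x y) (λ _ → ∑∈ T d) ⟩
    ∑[ x ∈ S ] ∑[ y ∈ T ] a x y - ∑[ x ∈ S ] ∑∈ T d
      ≡⟨ cong₂ _-_ (sym (cardIn≡∑∈∑∈ A S T)) (∑∈-const S (∑∈ T d)) ⟩
    cardIn A S T - ℕ→ℚ ∣ S ∣ * ∑∈ T d ∎
    where open ≡-Reasoning

  cardIn-E₁ : ∀ T → cardIn A E₁ T ≡ n₁ * ∑∈ T d
  cardIn-E₁ T = begin
    cardIn A E₁ T                     ≡⟨ cardIn≡∑∈∑∈ A E₁ T ⟩
    ∑[ x ∈ E₁ ] ∑[ y ∈ T ] a x y      ≡⟨ ∑∈-comm {S = E₁} {T = T} a ⟩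
    ∑[ y ∈ T ] ∑[ x ∈ E₁ ] a x y      ≡⟨ ∑∈-cong T (λ {y} _ → sym (n₁*d≡∑∈a y)) ⟩
    ∑[ y ∈ T ] (n₁ * d y)             ≡⟨ sym (*-distribˡ-∑∈ T n₁ d) ⟩
    n₁ * ∑∈ T d                       ∎
    where open ≡-Reasoning

  Increment : ℚ → ℚ → Subset N → Subset N → Set
  Increment δ η G₁ G₂ = δ * (ℕ→ℚ ∣ G₁ ∣ * ℕ→ℚ ∣ G₂ ∣) + η * (n₁ * n₂) < cardIn A G₁ G₂

  module _ (A⊆E₁×E₂ : ∀ x y → T (A x y) → (x ∈ E₁) × (y ∈ E₂))
           {δ : ℚ} (∣A∣≡δn₁n₂ : card A ≡ δ * (n₁ * n₂)) where

    card≡cardIn-E₁-E₂ : card A ≡ cardIn A E₁ E₂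
    card≡cardIn-E₁-E₂ = ∑-cong (λ x → ∑-cong (λ y → cong χ (A≡A∧E₁∧E₂ x y)))
      where
      A≡A∧E₁∧E₂ : ∀ x y → A x y ≡ A x y ∧ (lookup E₁ x ∧ lookup E₂ y)
      A≡A∧E₁∧E₂ x y with A x y in Axy
      ... | false = refl
      ... | true with A⊆E₁×E₂ x y (subst T (sym Axy) _)
      ...   | x∈E₁ , y∈E₂ rewrite []=⇒lookup x∈E₁ | []=⇒lookup y∈E₂ = refl

    cardIn-E₁-complement : ∀ {S} → S ⊆ E₂ → cardIn A E₁ (E₂ ∩ ∁ S) ≡ δ * (n₁ * n₂) - n₁ * ∑∈ S d
    cardIn-E₁-complement {S} S⊆E₂ = begin
      cardIn A E₁ (E₂ ∩ ∁ S)              ≡⟨ cardIn-E₁ (E₂ ∩ ∁ S) ⟩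
      n₁ * ∑∈ (E₂ ∩ ∁ S) d                ≡⟨ cong (n₁ *_) (∑∈-∩∁ S⊆E₂ d) ⟩
      n₁ * (∑∈ E₂ d - ∑∈ S d)             ≡⟨ x[y-z]≈xy-xz n₁ (∑∈ E₂ d) (∑∈ S d) ⟩
      n₁ * ∑∈ E₂ d - n₁ * ∑∈ S d          ≡⟨ cong (_- n₁ * ∑∈ S d) n₁∑∈E₂d≡δn₁n₂ ⟩
      δ * (n₁ * n₂) - n₁ * ∑∈ S d         ∎
      where
      open ≡-Reasoning
      n₁∑∈E₂d≡δn₁n₂ : n₁ * ∑∈ E₂ d ≡ δ * (n₁ * n₂)
      n₁∑∈E₂d≡δn₁n₂ = trans (sym (cardIn-E₁ E₂)) (trans (sym card≡cardIn-E₁-E₂) ∣A∣≡δn₁n₂)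

    density-increment : ∀ {η S₁ S₂} → 0ℚ ≤ η → S₁ ⊆ E₁ → S₂ ⊆ E₂ →
                        (η + η) * (n₁ * n₂) < ∑[ x ∈ S₁ ] ∑[ y ∈ S₂ ] f x y →
                        ∃₂ λ G₁ G₂ → G₁ ⊆ E₁ × G₂ ⊆ E₂ × Increment δ η G₁ G₂
    density-increment {η} {S₁} {S₂} 0≤η S₁⊆E₁ S₂⊆E₂ correlation =
      by-column-density (δ * s₂ - η * n₂ ≤? D)
      where
      s₁ s₂ D : ℚ
      s₁ = ℕ→ℚ ∣ S₁ ∣
      s₂ = ℕ→ℚ ∣ S₂ ∣
      D  = ∑∈ S₂ d

      by-column-density : Dec (δ * s₂ - η * n₂ ≤ D) → ∃₂ λ G₁ G₂ → G₁ ⊆ E₁ × G₂ ⊆ E₂ × Increment δ η G₁ G₂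
      by-column-density (yes δs₂-ηn₂≤D) = S₁ , S₂ , S₁⊆E₁ , S₂⊆E₂ ,
        increment-on-rectangle {η} {δ} {s₁} {s₂} {n₁} {n₂} {cardIn A S₁ S₂} {D}
          0≤η (0≤ℕ→ℚ ∣ S₁ ∣) (ℕ→ℚ-mono-≤ (p⊆q⇒∣p∣≤∣q∣ S₁⊆E₁)) (0≤ℕ→ℚ ∣ E₂ ∣)
          (subst ((η + η) * (n₁ * n₂) <_) (rectangle-sum S₁⊆E₁ S₂⊆E₂) correlation) δs₂-ηn₂≤D
      by-column-density (no δs₂-ηn₂≰D) = E₁ , E₂ ∩ ∁ S₂ , ⊆-refl , p∩q⊆p E₂ (∁ S₂) ,
        subst₂ _<_
          (cong (λ g → δ * (n₁ * g) + η * (n₁ * n₂)) (sym (∣E∩∁T∣≡∣E∣-∣T∣ {E = E₂} {T = S₂} S₂⊆E₂)))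
          (sym (cardIn-E₁-complement S₂⊆E₂))
          (increment-on-complement {η} {δ} {s₂} {n₁} {n₂} {D} 0<n₁ (≰⇒> δs₂-ηn₂≰D))

module _ {N : ℕ} (A : Rel N) {E₁ E₂ G₁ G₂ : Subset N} (G₁⊆E₁ : G₁ ⊆ E₁) (G₂⊆E₂ : G₂ ⊆ E₂) where

  private
    n₁ n₂ g₁ g₂ m : ℚ
    n₁ = ℕ→ℚ ∣ E₁ ∣
    n₂ = ℕ→ℚ ∣ E₂ ∣
    g₁ = ℕ→ℚ ∣ G₁ ∣
    g₂ = ℕ→ℚ ∣ G₂ ∣
    m  = ℕ→ℚ (∣ E₁ ∣ ⊓ ∣ E₂ ∣)

  -- An additive gain of η n₁ n₂ over the density δ only fits into G₁ × G₂ if gᵢ > η nᵢ.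
  increment⇒large : ∀ {δ η c} → 0ℚ ≤ δ → 0ℚ ≤ c → c ≤ η →
    δ * (g₁ * g₂) + η * (n₁ * n₂) < cardIn A G₁ G₂ →
    ((δ + c) * (g₁ * g₂) < cardIn A G₁ G₂) × (c * m < g₁) × (c * m < g₂)
  increment⇒large {δ} {η} {c} 0≤δ 0≤c c≤η increment = density , large₁ , large₂
    where
    open ≤-Reasoning
    0≤g₁ : 0ℚ ≤ g₁
    0≤g₁ = 0≤ℕ→ℚ ∣ G₁ ∣
    0≤g₂ : 0ℚ ≤ g₂
    0≤g₂ = 0≤ℕ→ℚ ∣ G₂ ∣
    g₁≤n₁ : g₁ ≤ n₁
    g₁≤n₁ = ℕ→ℚ-mono-≤ (p⊆q⇒∣p∣≤∣q∣ G₁⊆E₁)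
    g₂≤n₂ : g₂ ≤ n₂
    g₂≤n₂ = ℕ→ℚ-mono-≤ (p⊆q⇒∣p∣≤∣q∣ G₂⊆E₂)

    0≤δg₁g₂ : 0ℚ ≤ δ * (g₁ * g₂)
    0≤δg₁g₂ = *-preserves-0≤ 0≤δ (*-preserves-0≤ 0≤g₁ 0≤g₂)

    ηn₁n₂<g₁g₂ : η * (n₁ * n₂) < g₁ * g₂
    ηn₁n₂<g₁g₂ = begin-strict
      η * (n₁ * n₂)                   ≡⟨ sym (+-identityˡ _) ⟩
      0ℚ + η * (n₁ * n₂)              ≤⟨ +-monoˡ-≤ (η * (n₁ * n₂)) 0≤δg₁g₂ ⟩
      δ * (g₁ * g₂) + η * (n₁ * n₂)   <⟨ increment ⟩
      cardIn A G₁ G₂                  ≤⟨ cardIn≤∣G₁∣∣G₂∣ A G₁ G₂ ⟩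
      g₁ * g₂                         ∎

    cm≤ηn₁ : c * m ≤ η * n₁
    cm≤ηn₁ = *-mono-≤-0≤ 0≤c (0≤ℕ→ℚ (∣ E₁ ∣ ⊓ ∣ E₂ ∣)) c≤η (ℕ→ℚ-mono-≤ (ℕ.m⊓n≤m ∣ E₁ ∣ ∣ E₂ ∣))

    cm≤ηn₂ : c * m ≤ η * n₂
    cm≤ηn₂ = *-mono-≤-0≤ 0≤c (0≤ℕ→ℚ (∣ E₁ ∣ ⊓ ∣ E₂ ∣)) c≤η (ℕ→ℚ-mono-≤ (ℕ.m⊓n≤n ∣ E₁ ∣ ∣ E₂ ∣))

    ηn₁<g₁ : η * n₁ < g₁
    ηn₁<g₁ = *-<-*⇒< 0≤g₁ 0≤g₂ g₂≤n₂ (subst (_< g₁ * g₂) (sym (*-assoc η n₁ n₂)) ηn₁n₂<g₁g₂)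

    ηn₂<g₂ : η * n₂ < g₂
    ηn₂<g₂ = *-<-*⇒< 0≤g₂ 0≤g₁ g₁≤n₁ (subst₂ _<_ (a[bc]≡[ac]b η n₁ n₂) (*-comm g₁ g₂) ηn₁n₂<g₁g₂)
      where
      a[bc]≡[ac]b : ∀ a b c → a * (b * c) ≡ (a * c) * b
      a[bc]≡[ac]b = solve-∀ ℚ-ring

    large₁ : c * m < g₁
    large₁ = ≤-<-trans cm≤ηn₁ ηn₁<g₁

    large₂ : c * m < g₂
    large₂ = ≤-<-trans cm≤ηn₂ ηn₂<g₂

    cg₁g₂≤ηn₁n₂ : c * (g₁ * g₂) ≤ η * (n₁ * n₂)
    cg₁g₂≤ηn₁n₂ = *-mono-≤-0≤ 0≤c (*-preserves-0≤ 0≤g₁ 0≤g₂) c≤η (*-mono-≤-0≤ 0≤g₁ 0≤g₂ g₁≤n₁ g₂≤n₂)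

    density : (δ + c) * (g₁ * g₂) < cardIn A G₁ G₂
    density = begin-strict
      (δ + c) * (g₁ * g₂)             ≡⟨ *-distribʳ-+ (g₁ * g₂) δ c ⟩
      δ * (g₁ * g₂) + c * (g₁ * g₂)   ≤⟨ +-monoʳ-≤ (δ * (g₁ * g₂)) cg₁g₂≤ηn₁n₂ ⟩
      δ * (g₁ * g₂) + η * (n₁ * n₂)   <⟨ increment ⟩
      cardIn A G₁ G₂                  ∎

0≤2⁻⁵⁰⁰ : 0ℚ ≤ (+ 1) / (2 ^ 500)
0≤2⁻⁵⁰⁰ = toWitness {a? = 0ℚ ≤? (+ 1) / (2 ^ 500)} _

2⁻⁵⁰⁰α⁷⁰≤α/8 : ∀ {α} → 0ℚ ≤ α → α ≤ 1ℚ → ((+ 1) / (2 ^ 500)) * (α ^ℚ 70) ≤ α * ½ * ½ * ½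
2⁻⁵⁰⁰α⁷⁰≤α/8 {α} 0≤α α≤1 = begin
  ((+ 1) / (2 ^ 500)) * (α ^ℚ 70)  ≤⟨ *-mono-≤-0≤ 0≤2⁻⁵⁰⁰ (0≤pᵏ 0≤α 70) 2⁻⁵⁰⁰≤⅛ (p¹⁺ᵏ≤p 0≤α α≤1 69) ⟩
  ½ * ½ * ½ * α                    ≡⟨ *-comm (½ * ½ * ½) α ⟩
  α * (½ * ½ * ½)                  ≡⟨ sym (trans (*-assoc (α * ½) ½ ½) (*-assoc α ½ (½ * ½))) ⟩
  α * ½ * ½ * ½                    ∎
  where
  open ≤-Reasoning
  2⁻⁵⁰⁰≤⅛ : (+ 1) / (2 ^ 500) ≤ ½ * ½ * ½
  2⁻⁵⁰⁰≤⅛ = toWitness {a? = (+ 1) / (2 ^ 500) ≤? ½ * ½ * ½} _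

proposition4p10 :
    (N : ℕ) (E₁ E₂ : Subset N) → Nonempty E₁ → Nonempty E₂ →
    (A : Rel N) → (∀ x y → T (A x y) → (x ∈ E₁) × (y ∈ E₂)) →
    (δ : ℚ) → card A ≡ δ * (ℕ→ℚ ∣ E₁ ∣ * ℕ→ℚ ∣ E₂ ∣) →
    (α : ℚ) → 0ℚ < α → ¬ Uniform α E₁ E₂ A →
    ∃₂ λ (G₁ G₂ : Subset N) →
      (G₁ ⊆ E₁) × (G₂ ⊆ E₂) ×
      ((δ + ((+ 1) / (2 ^ 500)) * (α ^ℚ 70)) * (ℕ→ℚ ∣ G₁ ∣ * ℕ→ℚ ∣ G₂ ∣)
         < cardIn A G₁ G₂) ×
      ((((+ 1) / (2 ^ 500)) * (α ^ℚ 70)) * ℕ→ℚ (∣ E₁ ∣ ⊓ ∣ E₂ ∣) < ℕ→ℚ ∣ G₁ ∣) ×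
      ((((+ 1) / (2 ^ 500)) * (α ^ℚ 70)) * ℕ→ℚ (∣ E₁ ∣ ⊓ ∣ E₂ ∣) < ℕ→ℚ ∣ G₂ ∣)
proposition4p10 N E₁ E₂ E₁≢∅ E₂≢∅ A A⊆E₁×E₂ δ ∣A∣≡δn₁n₂ α 0<α not-uniform =
  let S₁ , S₂ , S₁⊆E₁ , S₂⊆E₂ , correlation = large-energy⇒rectangle α αM<energy
      G₁ , G₂ , G₁⊆E₁ , G₂⊆E₂ , increment = density-increment A⊆E₁×E₂ {δ} ∣A∣≡δn₁n₂ {η} 0≤η S₁⊆E₁ S₂⊆E₂
        (subst (_< ∑[ x ∈ S₁ ] ∑[ y ∈ S₂ ] f x y) (sym ([η+η]x≡α*x*½*½ α (n₁ * n₂))) correlation)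
  in G₁ , G₂ , G₁⊆E₁ , G₂⊆E₂ , increment⇒large A G₁⊆E₁ G₂⊆E₂ {δ} {η} 0≤δ 0≤2⁻⁵⁰⁰α⁷⁰ 2⁻⁵⁰⁰α⁷⁰≤η increment
  where
  open Balanced E₁ E₂ ⦃ nonempty⇒nonZero E₁≢∅ ⦄ A
  open Gram f {E₁} {E₂} ∣f∣≤𝟙𝟙 f-columns using (M; energy; large-energy⇒α<1; large-energy⇒rectangle)

  αM<energy : α * M < energy
  αM<energy = ≰⇒> not-uniform

  η : ℚ
  η = α * ½ * ½ * ½

  0≤η : 0ℚ ≤ η
  0≤η = *-preserves-0≤ (*-preserves-0≤ (*-preserves-0≤ (<⇒≤ 0<α) 0≤½) 0≤½) 0≤½

  [η+η]x≡α*x*½*½ : ∀ α x → (α * ½ * ½ * ½ + α * ½ * ½ * ½) * x ≡ α * x * ½ * ½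
  [η+η]x≡α*x*½*½ = solve-∀ ℚ-ring

  0≤δ : 0ℚ ≤ δ
  0≤δ = 0≤density A (*-preserves-0< 0<n₁ (0<ℕ→ℚ ∣ E₂ ∣ ⦃ nonempty⇒nonZero E₂≢∅ ⦄)) ∣A∣≡δn₁n₂

  0≤2⁻⁵⁰⁰α⁷⁰ : 0ℚ ≤ ((+ 1) / (2 ^ 500)) * (α ^ℚ 70)
  0≤2⁻⁵⁰⁰α⁷⁰ = *-preserves-0≤ 0≤2⁻⁵⁰⁰ (0≤pᵏ (<⇒≤ 0<α) 70)

  2⁻⁵⁰⁰α⁷⁰≤η : ((+ 1) / (2 ^ 500)) * (α ^ℚ 70) ≤ η
  2⁻⁵⁰⁰α⁷⁰≤η = 2⁻⁵⁰⁰α⁷⁰≤α/8 (<⇒≤ 0<α) (<⇒≤ (large-energy⇒α<1 α αM<energy))
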